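{- Let $r\in\mathbb{N}$, let $t,k\in\mathbb{N}$ with $t>\lceil\log_2 r\rceil$ and $k>\lceil\log_2 r\rceil$, let $j$ be any non-negative integer, and let $y_1,\dots,y_r\in\mathbb{Z}$ with $\sum_{i=1}^{r}y_i=0$. For each $i$ let $\tilde y_i$ be obtained from $y_i$ by arithmetic shift to the right by $t$ bits. Then $\big|\sum_{i=1}^{r}P^k_j(\tilde y_i)\big|<r \bmod 2^k$.
   Context: Integers are represented in sign-magnitude form; arithmetic shift to the right by $t$ bits keeps the sign and shifts the binary representation of the magnitude, i.e. $\tilde y=\mathrm{sign}(y)\lfloor |y|/2^t\rfloor$. For $k\in\mathbb{N}$ and $j\in\mathbb{N}\cup\{0\}$, $P^k_j(z)=\mathrm{sign}(z)\,z_j$, where $|z|=\sum_{i\ge0}z_i2^{ik}$ with $0\le z_i<2^k$ is the base-$2^k$ expansion of $|z|$ ($\mathrm{sign}(0)=0$). For an integer $x$, "$|x|<r \bmod 2^k$" means that $x$ is congruent modulo $2^k$ to some integer $c$ with $|c|<r$. -}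

module Defs where

open import Data.Nat as ℕ using (ℕ; _^_)
open import Data.Nat.Properties using (m^n≢0)
open import Data.Nat.DivMod using (_/_; _%_)
open import Data.Integer as ℤ using (ℤ; sign; _◃_; ∣_∣; _-_)
open import Data.Fin using (Fin)
open import Data.Product using (∃; _×_)
open import Relation.Binary.PropositionalEquality using (_≡_)
open import Data.Integer.Divisibility using (_∣_)

-- Arithmetic shift right by t bits in sign-magnitude form:
-- sign(y) * floor(|y| / 2^t)   (◃ yields 0 when the magnitude is 0)
shiftR : ℕ → ℤ → ℤ
shiftR t y = sign y ◃ ((∣ y ∣ / (2 ^ t)) {{m^n≢0 2 t}})

P : ℕ → ℕ → ℤ → ℤ
P k j z = sign z ◃ (((∣ z ∣ / (2 ^ (j ℕ.* k))) {{m^n≢0 2 (j ℕ.* k)}}) % (2 ^ k)) {{m^n≢0 2 k}}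

Σ : (r : ℕ) → (Fin r → ℤ) → ℤ
Σ ℕ.zero f = ℤ.0ℤ
Σ (ℕ.suc r) f = f Fin.zero ℤ.+ Σ r (λ i → f (Fin.suc i))
  where import Data.Fin as Fin

-- "|x| < r mod 2^k": x ≡ c (mod 2^k) for some integer c with |c| < r
AbsLtMod : ℤ → ℕ → ℕ → Set
AbsLtMod x r k = ∃ λ (c : ℤ) → (∣ c ∣ ℕ.< r) × (ℤ.+ (2 ^ k) ∣ (x - c))

-- Let M = 2^(t + j k). Shifting by t and then taking the j-th base-2^k digit is the
-- same as truncated division by M followed by reduction mod 2^k, so the sum of the
-- digits is congruent mod 2^k to the sum c of the truncated quotients of the y i
-- by M. Since the y i sum to 0, c M is minus the sum of the r remainders, each of
-- absolute value below M; hence |c| < r.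
module Submission where

open import Defs
open import Data.Nat using (ℕ; _<_; _≤_)
open import Data.Nat.Logarithm using (⌈log₂_⌉)
open import Data.Integer using (ℤ; 0ℤ)
open import Data.Fin using (Fin)
open import Relation.Binary.PropositionalEquality using (_≡_)

open import Data.Fin using (zero; suc)
open import Data.Integer using (+_; -_; _+_; _-_; _*_; _◃_; sign; ∣_∣)
import Data.Integer.Divisibility as Unsigned
import Data.Integer.Divisibility.Signed as Signed
import Data.Integer.Properties as ℤ
open import Algebra.Properties.AbelianGroup ℤ.+-0-abelianGroup using (inverseʳ-unique)
open import Algebra.Properties.CommutativeSemigroup ℤ.+-commutativeSemigroup using (interchange)
open import Data.Integer.Tactic.RingSolver using (solve-∀)
open import Data.Nat using (NonZero)
import Data.Nat as ℕ
open import Data.Nat.DivMod using (_/_; _%_; m/n/o≡m/[n*o]; 0/n≡0; m≡m%n+[m/n]*n; m%n<n; m<n⇒m%n≡m)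
import Data.Nat.Properties as ℕ
open import Data.Product using (_,_)
import Data.Sign as Sign
import Data.Sign.Properties as Sign
open import Function using (_∘_)
open import Relation.Binary.PropositionalEquality using (refl; sym; trans; cong; cong₂; subst; module ≡-Reasoning)

-- Division of integers truncated towards zero; shiftR t is quot (2 ^ t).
quot : (m : ℕ) .{{_ : NonZero m}} → ℤ → ℤ
quot m x = sign x ◃ (∣ x ∣ / m)

rem : (m : ℕ) .{{_ : NonZero m}} → ℤ → ℤ
rem m x = sign x ◃ (∣ x ∣ % m)

module _ (m : ℕ) .{{_ : NonZero m}} where

  x≡rem+quot*m : ∀ x → x ≡ rem m x + quot m x * + m
  x≡rem+quot*m x = begin
    x                                   ≡⟨ ℤ.◃-inverse x ⟨
    s ◃ ∣ x ∣                           ≡⟨ cong (s ◃_) (m≡m%n+[m/n]*n ∣ x ∣ m) ⟩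
    s ◃ (∣ x ∣ % m ℕ.+ ∣ x ∣ / m ℕ.* m) ≡⟨ ℤ.◃-distrib-+ s (∣ x ∣ % m) _ ⟩
    rem m x + (s ◃ (∣ x ∣ / m ℕ.* m))   ≡⟨ cong (λ v → rem m x + v) ◃-*-+ ⟩
    rem m x + quot m x * + m            ∎
    where
    open ≡-Reasoning
    s : Sign.Sign
    s = sign x
    ◃-*-+ : s ◃ (∣ x ∣ / m ℕ.* m) ≡ quot m x * + m
    ◃-*-+ = begin
      s ◃ (∣ x ∣ / m ℕ.* m)                 ≡⟨ cong (_◃ (∣ x ∣ / m ℕ.* m)) (Sign.*-identityʳ s) ⟨
      (s Sign.* Sign.+) ◃ (∣ x ∣ / m ℕ.* m) ≡⟨ ℤ.◃-distrib-* s Sign.+ (∣ x ∣ / m) m ⟩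
      quot m x * (Sign.+ ◃ m)               ≡⟨ cong (quot m x *_) (ℤ.+◃n≡+n m) ⟩
      quot m x * + m                        ∎

  ∣rem∣<m : ∀ x → ∣ rem m x ∣ < m
  ∣rem∣<m x rewrite ℤ.abs-◃ (sign x) (∣ x ∣ % m) = m%n<n ∣ x ∣ m

sign-◃-◃ : ∀ s n m → (n ≡ 0 → m ≡ 0) → sign (s ◃ n) ◃ m ≡ s ◃ m
sign-◃-◃ s ℕ.zero m n≡0⇒m≡0 rewrite n≡0⇒m≡0 refl = refl
sign-◃-◃ s (ℕ.suc n) m _ = cong (_◃ m) (ℤ.sign-◃ s (ℕ.suc n))

quot-quot : ∀ m n .{{_ : NonZero m}} .{{_ : NonZero n}} x →
            quot n (quot m x) ≡ quot (m ℕ.* n) {{ℕ.m*n≢0 m n}} x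
quot-quot m n x = begin
  sign (sign x ◃ q) ◃ (∣ sign x ◃ q ∣ / n) ≡⟨ cong (λ a → sign (sign x ◃ q) ◃ (a / n)) (ℤ.abs-◃ (sign x) q) ⟩
  sign (sign x ◃ q) ◃ (q / n)              ≡⟨ sign-◃-◃ (sign x) q (q / n) q≡0⇒q/n≡0 ⟩
  sign x ◃ (q / n)                         ≡⟨ cong (sign x ◃_) (m/n/o≡m/[n*o] ∣ x ∣ m n) ⟩
  quot (m ℕ.* n) {{ℕ.m*n≢0 m n}} x         ∎
  where
  open ≡-Reasoning
  instance _ = ℕ.m*n≢0 m n
  q : ℕ
  q = ∣ x ∣ / m
  q≡0⇒q/n≡0 : q ≡ 0 → q / n ≡ 0
  q≡0⇒q/n≡0 q≡0 rewrite q≡0 = 0/n≡0 n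

-- The signs agree because both sides vanish when the quotient does.
P≡rem-quot : ∀ k j z →
             P k j z ≡ rem (2 ℕ.^ k) {{ℕ.m^n≢0 2 k}} (quot (2 ℕ.^ (j ℕ.* k)) {{ℕ.m^n≢0 2 (j ℕ.* k)}} z)
P≡rem-quot k j z = sym (begin
  sign (sign z ◃ q) ◃ (∣ sign z ◃ q ∣ % K) ≡⟨ cong (λ a → sign (sign z ◃ q) ◃ (a % K)) (ℤ.abs-◃ (sign z) q) ⟩
  sign (sign z ◃ q) ◃ (q % K)              ≡⟨ sign-◃-◃ (sign z) q (q % K) q≡0⇒q%K≡0 ⟩
  sign z ◃ (q % K)                         ∎)
  where
  open ≡-Reasoning
  instance
    _ = ℕ.m^n≢0 2 k
    _ = ℕ.m^n≢0 2 (j ℕ.* k)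
  K q : ℕ
  K = 2 ℕ.^ k
  q = ∣ z ∣ / 2 ℕ.^ (j ℕ.* k)
  q≡0⇒q%K≡0 : q ≡ 0 → q % K ≡ 0
  q≡0⇒q%K≡0 q≡0 rewrite q≡0 = m<n⇒m%n≡m (ℕ.m^n>0 2 k)

Σ-cong : ∀ r {f g : Fin r → ℤ} → (∀ i → f i ≡ g i) → Σ r f ≡ Σ r g
Σ-cong ℕ.zero    _   = refl
Σ-cong (ℕ.suc r) f≗g = cong₂ _+_ (f≗g zero) (Σ-cong r (f≗g ∘ suc))

Σ-distrib-+ : ∀ r (f g : Fin r → ℤ) → Σ r (λ i → f i + g i) ≡ Σ r f + Σ r g
Σ-distrib-+ ℕ.zero    f g = refl
Σ-distrib-+ (ℕ.suc r) f g =
  trans (cong (λ v → f zero + g zero + v) (Σ-distrib-+ r (f ∘ suc) (g ∘ suc)))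
        (interchange (f zero) (g zero) (Σ r (f ∘ suc)) (Σ r (g ∘ suc)))

Σ-distribʳ-* : ∀ r (f : Fin r → ℤ) c → Σ r (λ i → f i * c) ≡ Σ r f * c
Σ-distribʳ-* ℕ.zero    f c = refl
Σ-distribʳ-* (ℕ.suc r) f c =
  trans (cong (λ v → f zero * c + v) (Σ-distribʳ-* r (f ∘ suc) c)) (sym (ℤ.*-distribʳ-+ c (f zero) _))

Σ-decompose : ∀ r {a : Fin r → ℤ} b c m → (∀ i → a i ≡ b i + c i * m) → Σ r a ≡ Σ r b + Σ r c * m
Σ-decompose r b c m a≗b+c*m = begin
  Σ r _                         ≡⟨ Σ-cong r a≗b+c*m ⟩
  Σ r (λ i → b i + c i * m)     ≡⟨ Σ-distrib-+ r b (λ i → c i * m) ⟩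
  Σ r b + Σ r (λ i → c i * m)   ≡⟨ cong (λ v → Σ r b + v) (Σ-distribʳ-* r c m) ⟩
  Σ r b + Σ r c * m             ∎
  where open ≡-Reasoning

∣Σ∣≤r*B : ∀ r {B} (g : Fin r → ℤ) → (∀ i → ∣ g i ∣ ≤ B) → ∣ Σ r g ∣ ≤ r ℕ.* B
∣Σ∣≤r*B ℕ.zero    g _   = ℕ.z≤n
∣Σ∣≤r*B (ℕ.suc r) g g≤B =
  ℕ.≤-trans (ℤ.∣i+j∣≤∣i∣+∣j∣ (g zero) _) (ℕ.+-mono-≤ (g≤B zero) (∣Σ∣≤r*B r (g ∘ suc) (g≤B ∘ suc)))

∣Σ∣<r*B : ∀ r {B} (g : Fin (ℕ.suc r) → ℤ) → (∀ i → ∣ g i ∣ < B) → ∣ Σ (ℕ.suc r) g ∣ < ℕ.suc r ℕ.* B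
∣Σ∣<r*B r g g<B = ℕ.≤-<-trans (ℤ.∣i+j∣≤∣i∣+∣j∣ (g zero) _)
  (ℕ.+-mono-<-≤ (g<B zero) (∣Σ∣≤r*B r (g ∘ suc) (ℕ.<⇒≤ ∘ g<B ∘ suc)))

∣Σquot∣<r : ∀ r m .{{_ : NonZero m}} (y : Fin (ℕ.suc r) → ℤ) → Σ (ℕ.suc r) y ≡ 0ℤ →
            ∣ Σ (ℕ.suc r) (quot m ∘ y) ∣ < ℕ.suc r
∣Σquot∣<r r m y Σy≡0 = ℕ.*-cancelʳ-< m _ _ (begin-strict
  ∣ Q ∣ ℕ.* m   ≡⟨ ℤ.abs-* Q (+ m) ⟨
  ∣ Q * + m ∣   ≡⟨ cong ∣_∣ Q*m≡-R ⟩
  ∣ - R ∣       ≡⟨ ℤ.∣-i∣≡∣i∣ R ⟩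
  ∣ R ∣         <⟨ ∣Σ∣<r*B r (rem m ∘ y) (∣rem∣<m m ∘ y) ⟩
  ℕ.suc r ℕ.* m ∎)
  where
  open ℕ.≤-Reasoning
  Q R : ℤ
  Q = Σ (ℕ.suc r) (quot m ∘ y)
  R = Σ (ℕ.suc r) (rem m ∘ y)
  Q*m≡-R : Q * + m ≡ - R
  Q*m≡-R = inverseʳ-unique R (Q * + m)
    (trans (sym (Σ-decompose (ℕ.suc r) (rem m ∘ y) (quot m ∘ y) (+ m) (x≡rem+quot*m m ∘ y))) Σy≡0)

m∣a-[a+c*m] : ∀ a c m → + m Unsigned.∣ a - (a + c * + m)
m∣a-[a+c*m] a c m = Signed.∣⇒∣ᵤ (Signed.divides (- c) (a-[a+c*m]≡-c*m a c (+ m)))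
  where
  a-[a+c*m]≡-c*m : ∀ a c m → a - (a + c * m) ≡ - c * m
  a-[a+c*m]≡-c*m = solve-∀

lemma3 : (r t k j : ℕ) → 1 ≤ r → ⌈log₂ r ⌉ < t → ⌈log₂ r ⌉ < k →
         (y : Fin r → ℤ) → Σ r y ≡ 0ℤ →
         AbsLtMod (Σ r (λ i → P k j (shiftR t (y i)))) r k
lemma3 ℕ.zero    _ _ _ ()
lemma3 (ℕ.suc r) t k j _ _ _ y Σy≡0 =
  Σ (ℕ.suc r) w , ∣Σquot∣<r r M y Σy≡0 ,
  subst (λ c → + K Unsigned.∣ ΣP - c) (sym Σw≡ΣP+Q*K) (m∣a-[a+c*m] ΣP (Σ (ℕ.suc r) (quot K ∘ w)) K)
  where
  instance
    _ = ℕ.m^n≢0 2 k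
    _ = ℕ.m^n≢0 2 t
    _ = ℕ.m^n≢0 2 (j ℕ.* k)
    _ = ℕ.m*n≢0 (2 ℕ.^ t) (2 ℕ.^ (j ℕ.* k))
  K M : ℕ
  K = 2 ℕ.^ k
  M = 2 ℕ.^ t ℕ.* 2 ℕ.^ (j ℕ.* k)
  w digit : Fin (ℕ.suc r) → ℤ
  w = quot M ∘ y
  digit i = P k j (shiftR t (y i))
  ΣP : ℤ
  ΣP = Σ (ℕ.suc r) digit

  digit≡rem : ∀ i → digit i ≡ rem K (w i)
  digit≡rem i = trans (P≡rem-quot k j _) (cong (rem K) (quot-quot (2 ℕ.^ t) (2 ℕ.^ (j ℕ.* k)) (y i)))

  Σw≡ΣP+Q*K : Σ (ℕ.suc r) w ≡ ΣP + Σ (ℕ.suc r) (quot K ∘ w) * + K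
  Σw≡ΣP+Q*K = Σ-decompose (ℕ.suc r) digit (quot K ∘ w) (+ K)
    (λ i → trans (x≡rem+quot*m K (w i)) (cong (_+ quot K (w i) * + K) (sym (digit≡rem i))))
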